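{- Let $G$ be a finite simple undirected connected graph and $M$ a prefix matching of $\Gamma$. Suppose that in $\Gamma^M$ there is a directed cycle $a_1\to b_1\to a_2\to\cdots\to a_p\to b_p\to a_{p+1}=a_1$, where each $a_i=(a_{i,0},\ldots,a_{i,k})$ is a sequence of length $k+1$, each $b_i=(b_{i,0},\ldots,b_{i,k-1})$ a sequence of length $k$, each edge $a_i\to b_i$ is an edge of $\Gamma$ with $b_i$ obtained from $a_i$ by deleting the entry of index $d_i$, and each edge $b_i\to a_{i+1}$ is a reversed matched edge with $a_{i+1}=(b_{i,0},\ldots,b_{i,c_i},u_i,b_{i,c_i+1},\ldots,b_{i,k-1})$ for some index $c_i$ and vertex $u_i$ (indices mod $p$). Assume moreover that $d_i=c_i+1$ and $d(a_{i+1,c_i},a_{i+1,c_i+1})=1$ for all $i$. Then $d(a_{i,d_i-1},a_{i,d_i})=1$ for all $i$.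
   Context: $d$ is the shortest-path metric of $G$, $\ell(x_0,\ldots,x_k)=\sum_{i=0}^{k-1}d(x_i,x_{i+1})$. A "sequence" means a tuple $(x_0,\ldots,x_k)\in V(G)^{k+1}$ ($k\ge 0$) with $x_i\ne x_{i+1}$ for all $i$. Let $\Gamma$ be the directed graph whose vertices are all sequences and with an edge $a\to b$ whenever $a=(x_0,\ldots,x_k)$ and $b=(x_0,\ldots,\hat x_i,\ldots,x_k)$ for some $1\le i\le k-1$ with $\ell(b)=\ell(a)$. A matching is a set of edges of $\Gamma$, no two sharing an endpoint; $\Gamma^M$ denotes $\Gamma$ with the edges of $M$ reversed. Relative to a matching, the matching state of a sequence $(x_0,\ldots,x_k)$ is: unmatched; insert$(i,v)$ if it is matched to $(x_0,\ldots,x_i,v,x_{i+1},\ldots,x_k)$; or delete$(i)$ if it is matched to $(x_0,\ldots,\hat x_i,\ldots,x_k)$. A prefix matching is a matching such that: if $(x_0,\ldots,x_k)$ has state insert$(i,v)$ (resp. delete$(i)$), then every sequence of the form $(x_0,\ldots,x_{i+1},y_{i+2},\ldots,y_{k'})$ has state insert$(i,v)$ (resp. delete$(i)$). -}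

module Defs where

open import Level using (0ℓ)
open import Data.Nat using (ℕ; zero; suc; _+_; _≤_; _<_)
open import Data.Nat.DivMod using (_mod_)
open import Data.Fin using (Fin; toℕ)
open import Data.List using (List; []; _∷_; length; take)
open import Data.Maybe using (Maybe; just; nothing)
open import Data.Product using (Σ; ∃; _×_; _,_)
open import Data.Sum using (_⊎_)
open import Relation.Nullary using (¬_; Dec)
open import Relation.Binary.PropositionalEquality using (_≡_; _≢_)

record Graph : Set₁ where
  field
    n      : ℕ
    Adj    : Fin n → Fin n → Set
    adj?   : ∀ x y → Dec (Adj x y)
    sym    : ∀ {x y} → Adj x y → Adj y x
    irrefl : ∀ {x} → ¬ Adj x x

open Graph public

V : Graph → Set
V G = Fin (n G)

data Walk (G : Graph) : V G → V G → ℕ → Set where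
  here : ∀ {x} → Walk G x x 0
  step : ∀ {x y z m} → Adj G x z → Walk G z y m → Walk G x y (suc m)

Connected : Graph → Set
Connected G = ∀ (x y : V G) → ∃ λ m → Walk G x y m

IsShortestPathMetric : (G : Graph) → (V G → V G → ℕ) → Set
IsShortestPathMetric G d =
  ∀ x y → Walk G x y (d x y) × (∀ m → Walk G x y m → d x y ≤ m)

nth : ∀ {A : Set} → List A → ℕ → Maybe A
nth []       _       = nothing
nth (x ∷ xs) zero    = just x
nth (x ∷ xs) (suc i) = nth xs i

del : ∀ {A : Set} → List A → ℕ → List A
del []       _       = []
del (x ∷ xs) zero    = xs
del (x ∷ xs) (suc i) = x ∷ del xs i

ins : ∀ {A : Set} → List A → ℕ → A → List A
ins []       _       v = v ∷ []
ins (x ∷ xs) zero    v = x ∷ v ∷ xs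
ins (x ∷ xs) (suc i) v = x ∷ ins xs i v

NoRepeat : ∀ {A : Set} → List A → Set
NoRepeat []               = Data.Unit.⊤ where import Data.Unit
NoRepeat (x ∷ [])         = Data.Unit.⊤ where import Data.Unit
NoRepeat (x ∷ y ∷ xs)     = x ≢ y × NoRepeat (y ∷ xs)

IsSeq : (G : Graph) → List (V G) → Set
IsSeq G xs = (1 ≤ length xs) × NoRepeat xs

ℓ : (G : Graph) → (V G → V G → ℕ) → List (V G) → ℕ
ℓ G d []           = 0
ℓ G d (x ∷ [])     = 0
ℓ G d (x ∷ y ∷ xs) = d x y + ℓ G d (y ∷ xs)

ΓEdge : (G : Graph) → (V G → V G → ℕ) → List (V G) → List (V G) → Set
ΓEdge G d a b =
  IsSeq G a × IsSeq G b ×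
  Σ ℕ (λ i → 1 ≤ i × suc (suc i) ≤ length a × b ≡ del a i × ℓ G d b ≡ ℓ G d a)

-- A set of edges of Γ, given as a relation M a b ("the edge a → b is in M")
EdgeSet : Graph → Set₁
EdgeSet G = List (V G) → List (V G) → Set

IsMatching : (G : Graph) → (V G → V G → ℕ) → EdgeSet G → Set
IsMatching G d M =
  (∀ a b → M a b → ΓEdge G d a b) ×
  (∀ a b a' b' → M a b → M a' b' →
     (a ≡ a' ⊎ a ≡ b' ⊎ b ≡ a' ⊎ b ≡ b') → (a ≡ a' × b ≡ b'))

HasInsert : (G : Graph) → EdgeSet G → List (V G) → ℕ → V G → Set
HasInsert G M s i v = M (ins s i v) s

HasDelete : (G : Graph) → EdgeSet G → List (V G) → ℕ → Set
HasDelete G M s i = M s (del s i)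

IsPrefixMatching : (G : Graph) → (V G → V G → ℕ) → EdgeSet G → Set
IsPrefixMatching G d M =
  IsMatching G d M ×
  (∀ s i v t → HasInsert G M s i v → IsSeq G t →
     take (suc (suc i)) t ≡ take (suc (suc i)) s → HasInsert G M t i v) ×
  (∀ s i t → HasDelete G M s i → IsSeq G t →
     take (suc (suc i)) t ≡ take (suc (suc i)) s → HasDelete G M t i)

next : ∀ {q} → Fin (suc q) → Fin (suc q)
next {q} i = suc (toℕ i) mod suc q

module Submission where

-- Weight a sequence by Φ(x₀,…,x_k) = Σᵢ (i − 1)·d(x_{i−1},x_i). The step aᵢ → aᵢ₊₁ of the
-- cycle replaces z = a_{i,cᵢ+1} by uᵢ, at distance 1 from x = a_{i,cᵢ}, without changing ℓ;
-- comparing the two edges around index cᵢ + 1 shows that Φ grows by exactly d(x,z) − 1 ≥ 0.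
-- Going once around the cycle returns to a₁, so none of these increments can be positive.

open import Defs hiding (sym)
open import Data.Nat using (ℕ; NonZero; zero; suc; _+_; _∸_; _≤_; _%_)
open import Data.Nat.Properties
  using (suc-injective; +-suc; +-assoc; +-identityʳ; +-cancelˡ-≡; +-cancelʳ-≤; +-monoʳ-≤; ≤-refl; ≤-trans; ≤-antisym; n≢0⇒n>0)
open import Data.Nat.DivMod using (m%n<n; m%n%n≡m%n; %-distribˡ-+; [m+n]%n≡m%n; m<n⇒m%n≡m)
open import Data.Nat.GeneralisedArithmetic using (iterate)
open import Data.Nat.Tactic.RingSolver using (solve-∀)
open import Data.Fin using (Fin; toℕ)
open import Data.Fin.Properties using (toℕ-injective; toℕ<n; toℕ-fromℕ<)
open import Data.List using (List; []; _∷_; length)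
open import Data.Maybe using (just)
open import Data.Product using (Σ; ∃; _×_; _,_; proj₁; proj₂)
open import Relation.Nullary using (¬_)
open import Relation.Binary.PropositionalEquality
  using (_≡_; _≢_; refl; sym; trans; cong; cong₂; subst; module ≡-Reasoning)

open ≡-Reasoning

private
  variable
    A : Set

[m%n+o]%n≡[m+o]%n : ∀ m o n → .{{_ : NonZero n}} → (m % n + o) % n ≡ (m + o) % n
[m%n+o]%n≡[m+o]%n m o n = begin
  (m % n + o) % n              ≡⟨ %-distribˡ-+ (m % n) o n ⟩
  (m % n % n + o % n) % n      ≡⟨ cong (λ t → (t + o % n) % n) (m%n%n≡m%n m n) ⟩
  (m % n + o % n) % n          ≡⟨ %-distribˡ-+ m o n ⟨
  (m + o) % n                  ∎

toℕ-iterate-next : ∀ {q} (j : Fin (suc q)) n → toℕ (iterate next j n) ≡ (toℕ j + n) % suc q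
toℕ-iterate-next {q} j zero = sym (begin
  (toℕ j + 0) % suc q  ≡⟨ cong (_% suc q) (+-identityʳ (toℕ j)) ⟩
  toℕ j % suc q        ≡⟨ m<n⇒m%n≡m (toℕ<n j) ⟩
  toℕ j                ∎)
toℕ-iterate-next {q} j (suc n) = begin
  toℕ (iterate next (next j) n)        ≡⟨ toℕ-iterate-next (next j) n ⟩
  (toℕ (next j) + n) % suc q           ≡⟨ cong (λ t → (t + n) % suc q) (toℕ-fromℕ< (m%n<n (suc (toℕ j)) (suc q))) ⟩
  (suc (toℕ j) % suc q + n) % suc q    ≡⟨ [m%n+o]%n≡[m+o]%n (suc (toℕ j)) n (suc q) ⟩
  (suc (toℕ j) + n) % suc q            ≡⟨ cong (_% suc q) (sym (+-suc (toℕ j) n)) ⟩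
  (toℕ j + suc n) % suc q              ∎

iterate-next-period : ∀ {q} (j : Fin (suc q)) → iterate next j (suc q) ≡ j
iterate-next-period {q} j = toℕ-injective (begin
  toℕ (iterate next j (suc q))  ≡⟨ toℕ-iterate-next j (suc q) ⟩
  (toℕ j + suc q) % suc q       ≡⟨ [m+n]%n≡m%n (toℕ j) (suc q) ⟩
  toℕ j % suc q                 ≡⟨ m<n⇒m%n≡m (toℕ<n j) ⟩
  toℕ j                         ∎)

≤-next⇒≡-next : ∀ {q} (f : Fin (suc q) → ℕ) → (∀ j → f j ≤ f (next j)) → ∀ j → f (next j) ≡ f j
≤-next⇒≡-next {q} f f≤f∘next j = ≤-antisym next≤ (f≤f∘next j)
  where
  f≤f∘iterate : ∀ j n → f j ≤ f (iterate next j n)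
  f≤f∘iterate j zero    = ≤-refl
  f≤f∘iterate j (suc n) = ≤-trans (f≤f∘next j) (f≤f∘iterate (next j) n)

  next≤ : f (next j) ≤ f j
  next≤ = subst (λ t → f (next j) ≤ f t) (iterate-next-period j) (f≤f∘iterate (next j) q)

del-shortens⇒nth-just : ∀ (a : List A) i → length a ≡ suc (length (del a i)) → ∃ λ z → nth a i ≡ just z
del-shortens⇒nth-just (x ∷ a) zero    _  = x , refl
del-shortens⇒nth-just (x ∷ a) (suc i) eq = del-shortens⇒nth-just a i (suc-injective eq)

nth-suc-just⇒nth-just : ∀ (a : List A) i {z} → nth a (suc i) ≡ just z → ∃ λ x → nth a i ≡ just x
nth-suc-just⇒nth-just (x ∷ a) zero    _  = x , refl
nth-suc-just⇒nth-just (x ∷ a) (suc i) eq = nth-suc-just⇒nth-just a i eq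

NoRepeat⇒nth-≢ : ∀ (a : List A) i {x z} → NoRepeat a → nth a i ≡ just x → nth a (suc i) ≡ just z → x ≢ z
NoRepeat⇒nth-≢ (x ∷ z ∷ a) zero    (x≢z , _) refl refl = x≢z
NoRepeat⇒nth-≢ (y ∷ h ∷ a) (suc i) (_ , nr) nx nz     = NoRepeat⇒nth-≢ (h ∷ a) i nr nx nz

replaceAfter : List A → ℕ → A → List A
replaceAfter a c u = ins (del a (suc c)) c u

nth-replaceAfter : ∀ (a : List A) c u {x} → nth a c ≡ just x →
                   nth (replaceAfter a c u) c ≡ just x × nth (replaceAfter a c u) (suc c) ≡ just u
nth-replaceAfter (x ∷ a) zero    u refl = refl , refl
nth-replaceAfter (y ∷ a) (suc c) u nx   = nth-replaceAfter a c u nx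

shortestPath-≡0⇒≡ : ∀ {G d} → IsShortestPathMetric G d → ∀ {x y} → d x y ≡ 0 → x ≡ y
shortestPath-≡0⇒≡ {G} metric {x} {y} dxy≡0 = empty-walk (subst (Walk G x y) dxy≡0 (proj₁ (metric x y)))
  where
  empty-walk : Walk G x y 0 → x ≡ y
  empty-walk here = refl

module Potential (G : Graph) (d : V G → V G → ℕ) where

  Φ : List (V G) → ℕ
  Φ []       = 0
  Φ (x ∷ xs) = ℓ G d xs + Φ xs

  ℓ-∷-replaceAfter : ∀ y h (t : List (V G)) c u →
                     ℓ G d (y ∷ replaceAfter (h ∷ t) c u) ≡ d y h + ℓ G d (replaceAfter (h ∷ t) c u)
  ℓ-∷-replaceAfter y h t zero    u = refl
  ℓ-∷-replaceAfter y h t (suc c) u = refl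

  Φ-∷-cong : ∀ y (xs xs' : List (V G)) {δ δ'} → ℓ G d xs' ≡ ℓ G d xs → Φ xs' + δ' ≡ Φ xs + δ →
             Φ (y ∷ xs') + δ' ≡ Φ (y ∷ xs) + δ
  Φ-∷-cong y xs xs' {δ} {δ'} ℓ≡ Φ≡ = begin
    (ℓ G d xs' + Φ xs') + δ'  ≡⟨ +-assoc (ℓ G d xs') (Φ xs') δ' ⟩
    ℓ G d xs' + (Φ xs' + δ')  ≡⟨ cong₂ _+_ ℓ≡ Φ≡ ⟩
    ℓ G d xs + (Φ xs + δ)     ≡⟨ +-assoc (ℓ G d xs) (Φ xs) δ ⟨
    (ℓ G d xs + Φ xs) + δ     ∎

  Φ-replaceAfter : ∀ (a : List (V G)) c u {x z} → nth a c ≡ just x → nth a (suc c) ≡ just z →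
                   ℓ G d (replaceAfter a c u) ≡ ℓ G d a → Φ (replaceAfter a c u) + d x u ≡ Φ a + d x z
  Φ-replaceAfter (x ∷ z ∷ t) zero u refl refl ℓ≡ = begin
    (ℓ G d (u ∷ t) + Φ t') + d x u  ≡⟨ rearrange (d x u) (ℓ G d (u ∷ t)) (Φ t') ⟩
    (d x u + ℓ G d (u ∷ t)) + Φ t'  ≡⟨ cong (_+ Φ t') ℓ≡ ⟩
    (d x z + ℓ G d (z ∷ t)) + Φ t'  ≡⟨ rearrange (d x z) (ℓ G d (z ∷ t)) (Φ t') ⟨
    (ℓ G d (z ∷ t) + Φ t') + d x z  ∎
    where
    t' = z ∷ t
    rearrange : ∀ p m r → (m + r) + p ≡ (p + m) + r
    rearrange = solve-∀
  Φ-replaceAfter (y ∷ h ∷ t) (suc c) u nx nz ℓ≡ =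
    Φ-∷-cong y (h ∷ t) (replaceAfter (h ∷ t) c u) tail-ℓ≡ (Φ-replaceAfter (h ∷ t) c u nx nz tail-ℓ≡)
    where
    tail-ℓ≡ : ℓ G d (replaceAfter (h ∷ t) c u) ≡ ℓ G d (h ∷ t)
    tail-ℓ≡ = +-cancelˡ-≡ (d y h) _ _ (trans (sym (ℓ-∷-replaceAfter y h t c u)) ℓ≡)

  Φ-replaceAfter-adjacent : ∀ (a : List (V G)) c u {a' x z} → a' ≡ replaceAfter a c u →
    nth a c ≡ just x → nth a (suc c) ≡ just z → ℓ G d a' ≡ ℓ G d a →
    (∀ x' u' → nth a' c ≡ just x' → nth a' (suc c) ≡ just u' → d x' u' ≡ 1) →
    Φ a' + 1 ≡ Φ a + d x z
  Φ-replaceAfter-adjacent a c u {x = x} refl nx nz ℓ≡ adjacent with nth-replaceAfter a c u nx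
  ... | nx' , nu' = trans (cong (Φ (replaceAfter a c u) +_) (sym (adjacent x u nx' nu')))
                          (Φ-replaceAfter a c u nx nz ℓ≡)

m+1≡n+δ⇒n≤m : ∀ {m n δ} → m + 1 ≡ n + δ → 1 ≤ δ → n ≤ m
m+1≡n+δ⇒n≤m {m} {n} eq 1≤δ = +-cancelʳ-≤ 1 n m (subst (n + 1 ≤_) (sym eq) (+-monoʳ-≤ n 1≤δ))

lemma3p12 : (G : Graph) → Connected G →
    (d : V G → V G → ℕ) → IsShortestPathMetric G d →
    (M : EdgeSet G) → IsPrefixMatching G d M →
    (q k : ℕ) →
    (a b : Fin (suc q) → List (V G)) →
    (dd c : Fin (suc q) → ℕ) → (u : Fin (suc q) → V G) →
    (∀ i → length (a i) ≡ suc k) →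
    (∀ i → length (b i) ≡ k) →
    (∀ i → ΓEdge G d (a i) (b i)) →
    (∀ i → ¬ M (a i) (b i)) →
    (∀ i → b i ≡ del (a i) (dd i)) →
    (∀ i → M (a (next i)) (b i)) →
    (∀ i → a (next i) ≡ ins (b i) (c i) (u i)) →
    (∀ i → dd i ≡ suc (c i)) →
    (∀ i x y → nth (a (next i)) (c i) ≡ just x →
       nth (a (next i)) (suc (c i)) ≡ just y → d x y ≡ 1) →
    ∀ i → Σ (V G) λ x → Σ (V G) λ y →
      nth (a i) (dd i ∸ 1) ≡ just x × nth (a i) (dd i) ≡ just y × d x y ≡ 1
lemma3p12 G _ d metric _ ((M⊆Γ , _) , _) q k a b dd c u |a| |b| aΓb _ b≡del aMb a≡ins dd≡ adjacent i
  rewrite dd≡ i = x i , z i , nth-x i , nth-z i , d[x,z]≡1 i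
  where
  open Potential G d

  b≡ : ∀ j → b j ≡ del (a j) (suc (c j))
  b≡ j = trans (b≡del j) (cong (del (a j)) (dd≡ j))

  ℓ-next : ∀ j → ℓ G d (a (next j)) ≡ ℓ G d (a j)
  ℓ-next j with aΓb j | M⊆Γ _ _ (aMb j)
  ... | _ , _ , _ , _ , _ , _ , ℓb≡ℓa | _ , _ , _ , _ , _ , _ , ℓb≡ℓa' = trans (sym ℓb≡ℓa') ℓb≡ℓa

  z-entry : ∀ j → ∃ λ z → nth (a j) (suc (c j)) ≡ just z
  z-entry j = del-shortens⇒nth-just (a j) (suc (c j))
    (trans (|a| j) (cong suc (sym (trans (cong length (sym (b≡ j))) (|b| j)))))

  x-entry : ∀ j → ∃ λ x → nth (a j) (c j) ≡ just x
  x-entry j = nth-suc-just⇒nth-just (a j) (c j) (proj₂ (z-entry j))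

  x z : Fin (suc q) → V G
  x j = proj₁ (x-entry j)
  z j = proj₁ (z-entry j)

  nth-x : ∀ j → nth (a j) (c j) ≡ just (x j)
  nth-x j = proj₂ (x-entry j)
  nth-z : ∀ j → nth (a j) (suc (c j)) ≡ just (z j)
  nth-z j = proj₂ (z-entry j)

  Φ-next : ∀ j → Φ (a (next j)) + 1 ≡ Φ (a j) + d (x j) (z j)
  Φ-next j = Φ-replaceAfter-adjacent (a j) (c j) (u j)
    (trans (a≡ins j) (cong (λ t → ins t (c j) (u j)) (b≡ j))) (nth-x j) (nth-z j) (ℓ-next j) (adjacent j)

  1≤d[x,z] : ∀ j → 1 ≤ d (x j) (z j)
  1≤d[x,z] j = n≢0⇒n>0 λ d≡0 →
    NoRepeat⇒nth-≢ (a j) (c j) (proj₂ (proj₁ (aΓb j))) (nth-x j) (nth-z j) (shortestPath-≡0⇒≡ metric d≡0)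

  Φ-next≡ : ∀ j → Φ (a (next j)) ≡ Φ (a j)
  Φ-next≡ = ≤-next⇒≡-next (λ j → Φ (a j)) (λ j → m+1≡n+δ⇒n≤m (Φ-next j) (1≤d[x,z] j))

  d[x,z]≡1 : ∀ j → d (x j) (z j) ≡ 1
  d[x,z]≡1 j = +-cancelˡ-≡ (Φ (a j)) _ _ (trans (sym (Φ-next j)) (cong (_+ 1) (Φ-next≡ j)))
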